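{- If $G$ is a finite simple bipartite graph with a perfect matching, then $f(G)\geq \delta(G)-1$. Moreover, the bound is tight: for all integers $0\le k\le n-1$ the bipartite graph $H_{n,k}$ satisfies $f(H_{n,k})=\delta(H_{n,k})-1$.
   Context: For a graph $G$ with a perfect matching $M$, a subset $S\subseteq M$ is a forcing set of $M$ if $S$ is contained in no perfect matching of $G$ other than $M$. $f(G,M)$ is the minimum size of a forcing set of $M$, and $f(G)=\min_M f(G,M)$ over all perfect matchings $M$. $\delta(G)$ is the minimum degree. $H_{n,k}$ is the bipartite graph with parts $\{u_1,\dots,u_n\}$ and $\{v_1,\dots,v_n\}$ in which $u_iv_j$ is a non-edge if and only if $1\leq i<j\leq n-k$. -}

module Defs where

open import Data.Nat using (ℕ; _<ᵇ_; _∸_; _≤_)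
open import Data.Bool using (Bool; true; false; not; _∧_)
open import Data.Fin using (Fin; toℕ)
open import Data.Fin.Subset using (Subset; _∈_; ∣_∣)
open import Data.Vec using (tabulate)
open import Data.Product using (Σ; _×_; _,_)
open import Data.Sum using (_⊎_)
open import Function.Definitions using (Injective)
open import Relation.Binary.PropositionalEquality using (_≡_)

-- A finite simple bipartite graph with parts U = {u_0..u_{n-1}} and
-- V = {v_0..v_{n-1}}, given by its biadjacency relation:
-- adj i j ≡ true  iff  u_i v_j is an edge.
-- (Any bipartite graph with a perfect matching has equal part sizes.)
BipGraph : ℕ → Set
BipGraph n = Fin n → Fin n → Bool

record PerfectMatching {n : ℕ} (G : BipGraph n) : Set where
  constructor pm
  field
    σ     : Fin n → Fin n
    inj   : Injective _≡_ _≡_ σ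
    edges : ∀ i → G i (σ i) ≡ true
open PerfectMatching public

SameMatching : ∀ {n} {G : BipGraph n} → PerfectMatching G → PerfectMatching G → Set
SameMatching M M' = ∀ i → σ M' i ≡ σ M i

-- A subset S of M is encoded by the set of U-indices i such that the edge
-- u_i v_(σ i) belongs to S; |S| = ∣ S ∣.
-- M' contains S  iff  M' uses every edge of S.
Contains : ∀ {n} {G : BipGraph n} → PerfectMatching G → PerfectMatching G → Subset n → Set
Contains M M' S = ∀ i → i ∈ S → σ M' i ≡ σ M i

IsForcingSet : ∀ {n} {G : BipGraph n} → PerfectMatching G → Subset n → Set
IsForcingSet {G = G} M S = (M' : PerfectMatching G) → Contains M M' S → SameMatching M M'

IsForcingNumber : ∀ {n} → BipGraph n → ℕ → Set
IsForcingNumber {n} G k =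
  Σ (PerfectMatching G) (λ M → Σ (Subset n) (λ S → IsForcingSet M S × ∣ S ∣ ≡ k))
  × ((M : PerfectMatching G) (S : Subset n) → IsForcingSet M S → k ≤ ∣ S ∣)

degU : ∀ {n} → BipGraph n → Fin n → ℕ
degU G i = ∣ tabulate (λ j → G i j) ∣

degV : ∀ {n} → BipGraph n → Fin n → ℕ
degV G j = ∣ tabulate (λ i → G i j) ∣

IsMinDegree : ∀ {n} → BipGraph n → ℕ → Set
IsMinDegree {n} G d =
  ((i : Fin n) → d ≤ degU G i) × ((j : Fin n) → d ≤ degV G j)
  × (Σ (Fin n) (λ i → degU G i ≡ d) ⊎ Σ (Fin n) (λ j → degV G j ≡ d))

HasPerfectMatching : ∀ {n} → BipGraph n → Set
HasPerfectMatching G = PerfectMatching G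

-- H_{n,k} (0-indexed: u_i v_j is a non-edge iff i < j < n - k,
-- i.e. 1 ≤ i+1 < j+1 ≤ n - k in the paper's 1-indexing).
H : (n k : ℕ) → BipGraph n
H n k i j = not ((toℕ i <ᵇ toℕ j) ∧ (toℕ j <ᵇ (n ∸ k)))

-- Let S be a forcing set of a perfect matching M. If some vertex outside S had
-- degree at least |S| + 2, then every vertex u outside S would be adjacent to
-- the M-partner of some other vertex outside S. Following these steps from u
-- eventually runs into a cycle, and rotating M along that cycle yields a second
-- perfect matching that still contains S, which is impossible. Hence
-- δ(G) ≤ |S| + 1 for every forcing set.
--
-- In H_{n,k} the identity matching is forced by its last k edges: in a perfect
-- matching M' containing them, the partner of u_i is v_i, a vertex to its left
-- or one of the last k vertices. In the last two cases that partner is already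
-- matched as in the identity (by induction from the left, resp. by assumption),
-- so injectivity of M' forces it to be v_i. Every vertex has degree at least
-- k + 1 because the last k vertices together with one universal vertex are
-- among its neighbours, and u_1 has exactly these.
module Submission where

open import Defs
open import Data.Bool using (Bool; true; false; not; _∧_; if_then_else_)
open import Data.Bool.Properties using (∧-zeroʳ; not-injective)
import Data.Bool.Properties as Bool
open import Data.Empty using (⊥-elim)
open import Data.Fin as Fin using (Fin; toℕ; fromℕ<; punchOut)
open import Data.Fin.Induction using (<-wellFounded)
open import Data.Fin.Permutation using (Permutation′; permutation)
open import Data.Fin.Properties
  using (any?; all?; ¬∀⟶∃¬; pigeonhole; punchOut-injective; <⇒notInjective; toℕ-injective; toℕ-fromℕ<; _≟_)
open import Data.Fin.Subset using (Subset; _∈_; _∉_; _⊆_; _⊂_; _∪_; ⁅_⁆; ⊤; ∣_∣)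
open import Data.Fin.Subset.Properties
  using (_∈?_; p⊆q⇒∣p∣≤∣q∣; p⊂q⇒∣p∣<∣q∣; ∣p∣≤n; ∣⊤∣≡n; ∣⁅x⁆∣≡1; x∈p∪q⁺; x∈⁅x⁆)
open import Data.Nat using (ℕ; zero; suc; _+_; _∸_; _≤_; _<_; _<ᵇ_; z≤n; s≤s; s≤s⁻¹)
open import Data.Nat.Properties
  using ( +-comm; +-suc; +-monoʳ-≤; n≤1+n; ≤-reflexive; n<1+n; ≤-refl; ≤-trans; ≤-antisym; <⇒≤; <⇒≱; ≮⇒≥; <-≤-trans
        ; ≤-<-connex; m≤n⇒m<n∨m≡n; n≤0⇒n≡0; m∸n+n≡m; m∸n≤m; m∸[m∸n]≡n; +-∸-assoc; ∸-monoˡ-≤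
        ; <ᵇ-reflects-<; +-0-commutativeMonoid; module ≤-Reasoning)
open import Data.Product using (Σ; ∃; ∃₂; _×_; _,_; proj₁; proj₂)
open import Data.Sum using (_⊎_; inj₁; inj₂)
open import Data.Vec using (_∷_; []; tabulate)
open import Data.Vec.Properties using (lookup∘tabulate; lookup⇒[]=; []=⇒lookup)
open import Function using (_∘_)
open import Function.Definitions using (Injective)
import Function.Endo.Propositional as Endo
open import Induction.WellFounded using (Acc; acc)
open import Relation.Binary.PropositionalEquality
  using (_≡_; _≢_; refl; sym; trans; cong; cong-app; subst; module ≡-Reasoning)
open import Relation.Nullary using (¬_; Dec; yes; no; contradiction)
open import Relation.Nullary.Decidable using (_×-dec_; _→-dec_; ¬?)
open import Relation.Nullary.Reflects using (ofʸ; ofⁿ)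
open import Relation.Unary using (Pred; Decidable)

open import Algebra.Properties.CommutativeMonoid.Sum +-0-commutativeMonoid using (sum; sum-permute)

∈-tabulate⁺ : ∀ {n} (f : Fin n → Bool) {i} → f i ≡ true → i ∈ tabulate f
∈-tabulate⁺ f {i} fi≡true = lookup⇒[]= i (tabulate f) (trans (lookup∘tabulate f i) fi≡true)

∈-tabulate⁻ : ∀ {n} (f : Fin n → Bool) {i} → i ∈ tabulate f → f i ≡ true
∈-tabulate⁻ f {i} i∈ = trans (sym (lookup∘tabulate f i)) ([]=⇒lookup i∈)

∣p∪q∣≤∣p∣+∣q∣ : ∀ {n} (p q : Subset n) → ∣ p ∪ q ∣ ≤ ∣ p ∣ + ∣ q ∣
∣p∪q∣≤∣p∣+∣q∣ []          []          = z≤n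
∣p∪q∣≤∣p∣+∣q∣ (true ∷ p)  (true ∷ q)  = s≤s (≤-trans (∣p∪q∣≤∣p∣+∣q∣ p q) (+-monoʳ-≤ ∣ p ∣ (n≤1+n ∣ q ∣)))
∣p∪q∣≤∣p∣+∣q∣ (true ∷ p)  (false ∷ q) = s≤s (∣p∪q∣≤∣p∣+∣q∣ p q)
∣p∪q∣≤∣p∣+∣q∣ (false ∷ p) (true ∷ q)  = ≤-trans (s≤s (∣p∪q∣≤∣p∣+∣q∣ p q)) (≤-reflexive (sym (+-suc ∣ p ∣ ∣ q ∣)))
∣p∪q∣≤∣p∣+∣q∣ (false ∷ p) (false ∷ q) = ∣p∪q∣≤∣p∣+∣q∣ p q

∣p∪⁅x⁆∣≤suc∣p∣ : ∀ {n} (p : Subset n) x → ∣ p ∪ ⁅ x ⁆ ∣ ≤ suc ∣ p ∣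
∣p∪⁅x⁆∣≤suc∣p∣ p x = begin
  ∣ p ∪ ⁅ x ⁆ ∣     ≤⟨ ∣p∪q∣≤∣p∣+∣q∣ p ⁅ x ⁆ ⟩
  ∣ p ∣ + ∣ ⁅ x ⁆ ∣ ≡⟨ cong (∣ p ∣ +_) (∣⁅x⁆∣≡1 x) ⟩
  ∣ p ∣ + 1         ≡⟨ +-comm ∣ p ∣ 1 ⟩
  suc ∣ p ∣         ∎
  where open ≤-Reasoning

injective⇒surjective : ∀ {n} (f : Fin n → Fin n) → Injective _≡_ _≡_ f → ∀ y → ∃ λ x → f x ≡ y
injective⇒surjective {suc m} f f-injective y with any? (λ x → f x ≟ y)
... | yes hit = hit
... | no miss = ⊥-elim (<⇒notInjective (n<1+n m) f-without-y-injective)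
  where
  y≢f : ∀ x → y ≢ f x
  y≢f x y≡fx = miss (x , sym y≡fx)

  f-without-y : Fin (suc m) → Fin m
  f-without-y x = punchOut (y≢f x)

  f-without-y-injective : Injective _≡_ _≡_ f-without-y
  f-without-y-injective {x} {x′} e = f-injective (punchOut-injective (y≢f x) (y≢f x′) e)

∣tabulate∣≡sum : ∀ {n} (f : Fin n → Bool) → ∣ tabulate f ∣ ≡ sum (λ i → if f i then 1 else 0)
∣tabulate∣≡sum {zero}  f = refl
∣tabulate∣≡sum {suc n} f with f Fin.zero
... | true  = cong suc (∣tabulate∣≡sum (f ∘ Fin.suc))
... | false = ∣tabulate∣≡sum (f ∘ Fin.suc)

∣tabulate∘injective∣ : ∀ {n} (ρ : Fin n → Fin n) → Injective _≡_ _≡_ ρ →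
                       (f : Fin n → Bool) → ∣ tabulate (f ∘ ρ) ∣ ≡ ∣ tabulate f ∣
∣tabulate∘injective∣ {n} ρ ρ-injective f = begin
  ∣ tabulate (f ∘ ρ) ∣                    ≡⟨ ∣tabulate∣≡sum (f ∘ ρ) ⟩
  sum (λ i → if f (ρ i) then 1 else 0)   ≡⟨ sum-permute (λ i → if f i then 1 else 0) π ⟨
  sum (λ i → if f i then 1 else 0)       ≡⟨ ∣tabulate∣≡sum f ⟨
  ∣ tabulate f ∣                          ∎
  where
  open ≡-Reasoning
  ρ-surjective : ∀ y → ∃ λ x → ρ x ≡ y
  ρ-surjective = injective⇒surjective ρ ρ-injective

  π : Permutation′ n
  π = permutation ρ (proj₁ ∘ ρ-surjective) (proj₂ ∘ ρ-surjective)
                    (λ x → ρ-injective (proj₂ (ρ-surjective (ρ x))))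

-- u can be rematched to the M-partner of w, a vertex outside S other than u.
AlternatingStep : ∀ {n} {G : BipGraph n} → PerfectMatching G → Subset n → Fin n → Fin n → Set
AlternatingStep {G = G} M S u w = w ∉ S × w ≢ u × G u (σ M w) ≡ true

alternatingStep? : ∀ {n} {G : BipGraph n} (M : PerfectMatching G) (S : Subset n) u w →
                   Dec (AlternatingStep M S u w)
alternatingStep? {G = G} M S u w = ¬? (w ∈? S) ×-dec ¬? (w ≟ u) ×-dec (G u (σ M w) Bool.≟ true)

noAlternatingStep⇒degU≤ : ∀ {n} {G : BipGraph n} (M : PerfectMatching G) (S : Subset n) {u} →
                          (∀ w → ¬ AlternatingStep M S u w) → degU G u ≤ suc ∣ S ∣
noAlternatingStep⇒degU≤ {G = G} M S {u} stuck = begin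
  degU G u                  ≡⟨ ∣tabulate∘injective∣ (σ M) (inj M) (G u) ⟨
  ∣ tabulate (G u ∘ σ M) ∣  ≤⟨ p⊆q⇒∣p∣≤∣q∣ partners⊆S∪u ⟩
  ∣ S ∪ ⁅ u ⁆ ∣             ≤⟨ ∣p∪⁅x⁆∣≤suc∣p∣ S u ⟩
  suc ∣ S ∣                 ∎
  where
  open ≤-Reasoning
  partners⊆S∪u : tabulate (G u ∘ σ M) ⊆ S ∪ ⁅ u ⁆
  partners⊆S∪u {w} w∈ with w ∈? S | w ≟ u
  ... | yes w∈S | _       = x∈p∪q⁺ (inj₁ w∈S)
  ... | no _    | yes refl = x∈p∪q⁺ (inj₂ (x∈⁅x⁆ u))
  ... | no w∉S  | no w≢u  = contradiction (w∉S , w≢u , ∈-tabulate⁻ (G u ∘ σ M) w∈) (stuck w)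

module Iteration {n} (g : Fin n → Fin n) where
  open Endo (Fin n) public using (_^_)
  open Endo (Fin n) using (^-homo)

  ^-suc′ : ∀ p x → (g ^ suc p) x ≡ (g ^ p) (g x)
  ^-suc′ p x = trans (cong (λ m → (g ^ m) x) (+-comm 1 p)) (cong-app (^-homo g p 1) x)

  ^-preserves : ∀ {ℓ} (P : Pred (Fin n) ℓ) → (∀ {x} → P x → P (g x)) → ∀ i {x} → P x → P ((g ^ i) x)
  ^-preserves P g-preserves zero    Px = Px
  ^-preserves P g-preserves (suc i) Px = g-preserves (^-preserves P g-preserves i Px)

  eventuallyPeriodic : ∀ x → ∃₂ λ i p → (g ^ suc p) ((g ^ i) x) ≡ (g ^ i) x
  eventuallyPeriodic x with pigeonhole (n<1+n n) (λ t → (g ^ toℕ t) x)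
  ... | i , j , i<j , gⁱx≡gʲx = toℕ i , p , (begin
    (g ^ suc p) ((g ^ toℕ i) x)  ≡⟨ cong-app (^-homo g (suc p) (toℕ i)) x ⟨
    (g ^ (suc p + toℕ i)) x      ≡⟨ cong (λ m → (g ^ m) x) (trans (sym (+-suc p (toℕ i))) (m∸n+n≡m i<j)) ⟩
    (g ^ toℕ j) x                ≡⟨ gⁱx≡gʲx ⟨
    (g ^ toℕ i) x                ∎)
    where
    open ≡-Reasoning
    p : ℕ
    p = toℕ j ∸ suc (toℕ i)

module AlternatingCycle {n} {G : BipGraph n} (M : PerfectMatching G) (S : Subset n)
  (g : Fin n → Fin n) (step : ∀ {u} → u ∉ S → AlternatingStep M S u (g u)) where
  open Iteration g
  open ≡-Reasoning

  module _ (p : ℕ) where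

    OnCycle : Fin n → Set
    OnCycle x = x ∉ S × (g ^ suc p) x ≡ x

    onCycle? : ∀ x → Dec (OnCycle x)
    onCycle? x = ¬? (x ∈? S) ×-dec ((g ^ suc p) x ≟ x)

    g-onCycle : ∀ {x} → OnCycle x → OnCycle (g x)
    g-onCycle {x} (x∉S , cycle) = proj₁ (step x∉S) , (begin
      g ((g ^ p) (g x))  ≡⟨ cong g (^-suc′ p x) ⟨
      g ((g ^ suc p) x)  ≡⟨ cong g cycle ⟩
      g x                ∎)

    g-injectiveOnCycle : ∀ {x y} → OnCycle x → OnCycle y → g x ≡ g y → x ≡ y
    g-injectiveOnCycle {x} {y} (_ , x-cycle) (_ , y-cycle) gx≡gy = begin
      x                  ≡⟨ x-cycle ⟨
      (g ^ suc p) x      ≡⟨ ^-suc′ p x ⟩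
      (g ^ p) (g x)      ≡⟨ cong (g ^ p) gx≡gy ⟩
      (g ^ p) (g y)      ≡⟨ ^-suc′ p y ⟨
      (g ^ suc p) y      ≡⟨ y-cycle ⟩
      y                  ∎

    rotatedPartner : Fin n → Fin n
    rotatedPartner u with onCycle? u
    ... | yes _ = σ M (g u)
    ... | no  _ = σ M u

    rotatedPartner-injective : Injective _≡_ _≡_ rotatedPartner
    rotatedPartner-injective {x} {y} e with onCycle? x | onCycle? y
    ... | yes x-on | yes y-on = g-injectiveOnCycle x-on y-on (inj M e)
    ... | yes x-on | no y-off = contradiction (subst OnCycle (inj M e) (g-onCycle x-on)) y-off
    ... | no x-off | yes y-on = contradiction (subst OnCycle (inj M (sym e)) (g-onCycle y-on)) x-off
    ... | no _     | no _     = inj M e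

    rotatedPartner-edge : ∀ u → G u (rotatedPartner u) ≡ true
    rotatedPartner-edge u with onCycle? u
    ... | yes (u∉S , _) = proj₂ (proj₂ (step u∉S))
    ... | no _          = edges M u

    rotated : PerfectMatching G
    rotated = pm rotatedPartner rotatedPartner-injective rotatedPartner-edge

    rotated-contains : Contains M rotated S
    rotated-contains u u∈S with onCycle? u
    ... | yes (u∉S , _) = contradiction u∈S u∉S
    ... | no _          = refl

    rotated-moves : ∀ {c} → OnCycle c → σ rotated c ≢ σ M c
    rotated-moves {c} c-on with onCycle? c
    ... | yes (c∉S , _) = proj₁ (proj₂ (step c∉S)) ∘ inj M
    ... | no c-off      = contradiction c-on c-off

  ¬forcing : ∀ {u} → u ∉ S → ¬ IsForcingSet M S
  ¬forcing {u} u∉S forcing with eventuallyPeriodic u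
  ... | i , p , cycle =
    rotated-moves p c-on (forcing (rotated p) (rotated-contains p) c)
    where
    c : Fin n
    c = (g ^ i) u
    c-on : OnCycle p c
    c-on = ^-preserves (_∉ S) (proj₁ ∘ step) i u∉S , cycle

alternatingSteps⇒¬forcing : ∀ {n} {G : BipGraph n} (M : PerfectMatching G) (S : Subset n) →
                            (∀ u → u ∉ S → ∃ (AlternatingStep M S u)) → ∀ {u} → u ∉ S → ¬ IsForcingSet M S
alternatingSteps⇒¬forcing {n} M S steps = AlternatingCycle.¬forcing M S next next-step
  where
  next : Fin n → Fin n
  next u with u ∈? S
  ... | yes _   = u
  ... | no u∉S  = proj₁ (steps u u∉S)

  next-step : ∀ {u} → u ∉ S → AlternatingStep M S u (next u)
  next-step {u} u∉S with u ∈? S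
  ... | yes u∈S = contradiction u∈S u∉S
  ... | no u∉S′ = proj₂ (steps u u∉S′)

stepsOutside? : ∀ {n} {G : BipGraph n} (M : PerfectMatching G) (S : Subset n) →
                Decidable (λ u → u ∉ S → ∃ (AlternatingStep M S u))
stepsOutside? M S u = ¬? (u ∈? S) →-dec any? (alternatingStep? M S u)

minDegree≤n : ∀ {n} {G : BipGraph n} {d} → IsMinDegree G d → d ≤ n
minDegree≤n {G = G} (_ , _ , inj₁ (i , degUi≡d)) = subst (_≤ _) degUi≡d (∣p∣≤n (tabulate (G i)))
minDegree≤n {G = G} (_ , _ , inj₂ (j , degVj≡d)) = subst (_≤ _) degVj≡d (∣p∣≤n (tabulate (λ i → G i j)))

minDegree≤suc∣forcingSet∣ : ∀ {n} {G : BipGraph n} {M : PerfectMatching G} {S : Subset n} {d} →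
                            IsMinDegree G d → IsForcingSet M S → d ≤ suc ∣ S ∣
minDegree≤suc∣forcingSet∣ {n} {M = M} {S} {d} minDegree forcing with all? (stepsOutside? M S)
... | no ¬steps with u , ¬stepᵤ ← ¬∀⟶∃¬ n _ (stepsOutside? M S) ¬steps =
  ≤-trans (proj₁ minDegree u) (noAlternatingStep⇒degU≤ M S (λ w stepᵤw → ¬stepᵤ (λ _ → w , stepᵤw)))
... | yes steps with all? (_∈? S)
...   | no ¬⊤⊆S = contradiction forcing (alternatingSteps⇒¬forcing M S steps (proj₂ (¬∀⟶∃¬ n _ (_∈? S) ¬⊤⊆S)))
...   | yes ⊤⊆S = begin
  d          ≤⟨ minDegree≤n minDegree ⟩
  n          ≡⟨ ∣⊤∣≡n n ⟨
  ∣ ⊤ {n} ∣  ≤⟨ p⊆q⇒∣p∣≤∣q∣ {p = ⊤} (λ {x} _ → ⊤⊆S x) ⟩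
  ∣ S ∣      ≤⟨ n≤1+n ∣ S ∣ ⟩
  suc ∣ S ∣  ∎
  where open ≤-Reasoning

minDegree∸1≤forcingNumber : (n : ℕ) (G : BipGraph n) → HasPerfectMatching G →
                            (d k : ℕ) → IsMinDegree G d → IsForcingNumber G k → d ∸ 1 ≤ k
minDegree∸1≤forcingNumber _ _ _ _ _ minDegree ((M , _ , forcing , refl) , _) =
  ∸-monoˡ-≤ 1 (minDegree≤suc∣forcingSet∣ {M = M} minDegree forcing)

<ᵇ≡false : ∀ {m n} → n ≤ m → (m <ᵇ n) ≡ false
<ᵇ≡false {m} {n} n≤m with m <ᵇ n | <ᵇ-reflects-< m n
... | false | _       = refl
... | true  | ofʸ m<n = contradiction n≤m (<⇒≱ m<n)

<ᵇ≡false⇒≥ : ∀ {m n} → (m <ᵇ n) ≡ false → n ≤ m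
<ᵇ≡false⇒≥ {m} {n} m<ᵇn≡false with m <ᵇ n | <ᵇ-reflects-< m n | m<ᵇn≡false
... | false | ofⁿ m≮n | _ = ≮⇒≥ m≮n

atLeast : ∀ {n} → ℕ → Subset n
atLeast N = tabulate (λ j → not (toℕ j <ᵇ N))

∣atLeast∣ : ∀ n N → ∣ atLeast {n} N ∣ ≡ n ∸ N
∣atLeast∣ zero    zero    = refl
∣atLeast∣ zero    (suc N) = refl
∣atLeast∣ (suc n) zero    = cong suc (∣atLeast∣ n zero)
∣atLeast∣ (suc n) (suc N) = ∣atLeast∣ n N

∈atLeast⁺ : ∀ {n N} {j : Fin n} → N ≤ toℕ j → j ∈ atLeast N
∈atLeast⁺ N≤j = ∈-tabulate⁺ _ (cong not (<ᵇ≡false N≤j))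

∈atLeast⁻ : ∀ {n N} {j : Fin n} → j ∈ atLeast N → N ≤ toℕ j
∈atLeast⁻ j∈ = <ᵇ≡false⇒≥ (not-injective (∈-tabulate⁻ _ j∈))

module _ {n : ℕ} (k : ℕ) where

  H-edge⁺ : ∀ {i j : Fin n} → toℕ j ≤ toℕ i ⊎ n ∸ k ≤ toℕ j → H n k i j ≡ true
  H-edge⁺ {i} {j} (inj₁ j≤i) = cong (λ b → not (b ∧ (toℕ j <ᵇ n ∸ k))) (<ᵇ≡false j≤i)
  H-edge⁺ {i} {j} (inj₂ N≤j) =
    trans (cong (λ b → not ((toℕ i <ᵇ toℕ j) ∧ b)) (<ᵇ≡false N≤j)) (cong not (∧-zeroʳ _))

  H-edge⁻ : ∀ {i j : Fin n} → H n k i j ≡ true → toℕ j ≤ toℕ i ⊎ n ∸ k ≤ toℕ j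
  H-edge⁻ {i} {j} edge with toℕ i <ᵇ toℕ j in i<ᵇj | toℕ j <ᵇ n ∸ k in j<ᵇN
  ... | false | _     = inj₁ (<ᵇ≡false⇒≥ i<ᵇj)
  ... | true  | false = inj₂ (<ᵇ≡false⇒≥ j<ᵇN)
  ... | true  | true  = contradiction edge λ ()

  H-edge-fromLast : ∀ {i j : Fin n} → n ∸ k ≤ toℕ i → H n k i j ≡ true
  H-edge-fromLast {i} {j} N≤i with ≤-<-connex (n ∸ k) (toℕ j)
  ... | inj₁ N≤j = H-edge⁺ (inj₂ N≤j)
  ... | inj₂ j<N = H-edge⁺ (inj₁ (<⇒≤ (<-≤-trans j<N N≤i)))

  identityMatching : PerfectMatching (H n k)
  identityMatching = pm (λ i → i) (λ i≡j → i≡j) (λ i → H-edge⁺ (inj₁ ≤-refl))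

  last-forces-identity : IsForcingSet identityMatching (atLeast (n ∸ k))
  last-forces-identity M′ fixesLast i = fixed i (<-wellFounded i)
    where
    fixed : ∀ i → Acc Fin._<_ i → σ M′ i ≡ i
    fixed i (acc smaller) with H-edge⁻ (edges M′ i)
    ... | inj₂ N≤σi = inj M′ (fixesLast (σ M′ i) (∈atLeast⁺ N≤σi))
    ... | inj₁ σi≤i with m≤n⇒m<n∨m≡n σi≤i
    ...   | inj₁ σi<i = inj M′ (fixed (σ M′ i) (smaller σi<i))
    ...   | inj₂ σi≡i = toℕ-injective σi≡i

module Tightness (m k : ℕ) (k≤m : k ≤ m) where
  open ≤-Reasoning

  Last : Subset (suc m)
  Last = atLeast (suc m ∸ k)

  ∣Last∣ : ∣ Last ∣ ≡ k
  ∣Last∣ = trans (∣atLeast∣ (suc m) (suc m ∸ k)) (m∸[m∸n]≡n (≤-trans k≤m (n≤1+n m)))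

  suc-m∸k≡suc[m∸k] : suc m ∸ k ≡ suc (m ∸ k)
  suc-m∸k≡suc[m∸k] = +-∸-assoc 1 k≤m

  beforeLast : Fin (suc m)
  beforeLast = fromℕ< (s≤s (m∸n≤m m k))

  beforeLast∉Last : beforeLast ∉ Last
  beforeLast∉Last beforeLast∈ = <⇒≱ (n<1+n (m ∸ k)) (begin
    suc (m ∸ k)     ≡⟨ suc-m∸k≡suc[m∸k] ⟨
    suc m ∸ k       ≤⟨ ∈atLeast⁻ beforeLast∈ ⟩
    toℕ beforeLast  ≡⟨ toℕ-fromℕ< _ ⟩
    m ∸ k           ∎)

  zero∉Last : Fin.zero ∉ Last
  zero∉Last zero∈ with () ← subst (_≤ 0) suc-m∸k≡suc[m∸k] (∈atLeast⁻ zero∈)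

  beforeLast-universal : ∀ j → H (suc m) k beforeLast j ≡ true
  beforeLast-universal j with ≤-<-connex (toℕ j) (m ∸ k)
  ... | inj₁ j≤m∸k = H-edge⁺ k (inj₁ (subst (toℕ j ≤_) (sym (toℕ-fromℕ< _)) j≤m∸k))
  ... | inj₂ m∸k<j = H-edge⁺ k (inj₂ (subst (_≤ toℕ j) (sym suc-m∸k≡suc[m∸k]) m∸k<j))

  Last⊂neighboursU : ∀ i → Last ⊂ tabulate (H (suc m) k i)
  Last⊂neighboursU i =
    (λ j∈ → ∈-tabulate⁺ (H (suc m) k i) (H-edge⁺ k (inj₂ (∈atLeast⁻ j∈)))) ,
    Fin.zero , ∈-tabulate⁺ (H (suc m) k i) (H-edge⁺ k {i = i} {j = Fin.zero} (inj₁ z≤n)) , zero∉Last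

  Last⊂neighboursV : ∀ j → Last ⊂ tabulate (λ i → H (suc m) k i j)
  Last⊂neighboursV j =
    (λ i∈ → ∈-tabulate⁺ (λ i → H (suc m) k i j) (H-edge-fromLast k (∈atLeast⁻ i∈))) ,
    beforeLast , ∈-tabulate⁺ (λ i → H (suc m) k i j) (beforeLast-universal j) , beforeLast∉Last

  neighboursU-zero⊆ : tabulate (H (suc m) k Fin.zero) ⊆ Last ∪ ⁅ Fin.zero ⁆
  neighboursU-zero⊆ j∈ with H-edge⁻ k (∈-tabulate⁻ (H (suc m) k Fin.zero) j∈)
  ... | inj₁ j≤0 = x∈p∪q⁺ (inj₂ (subst (_∈ ⁅ Fin.zero ⁆) (sym (toℕ-injective (n≤0⇒n≡0 j≤0))) (x∈⁅x⁆ Fin.zero)))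
  ... | inj₂ N≤j = x∈p∪q⁺ (inj₁ (∈atLeast⁺ N≤j))

  suc-k≤degU : ∀ i → suc k ≤ degU (H (suc m) k) i
  suc-k≤degU i = subst (_< degU (H (suc m) k) i) ∣Last∣ (p⊂q⇒∣p∣<∣q∣ (Last⊂neighboursU i))

  suc-k≤degV : ∀ j → suc k ≤ degV (H (suc m) k) j
  suc-k≤degV j = subst (_< degV (H (suc m) k) j) ∣Last∣ (p⊂q⇒∣p∣<∣q∣ (Last⊂neighboursV j))

  degU-zero≤suc-k : degU (H (suc m) k) Fin.zero ≤ suc k
  degU-zero≤suc-k = begin
    degU (H (suc m) k) Fin.zero  ≤⟨ p⊆q⇒∣p∣≤∣q∣ neighboursU-zero⊆ ⟩
    ∣ Last ∪ ⁅ Fin.zero ⁆ ∣      ≤⟨ ∣p∪⁅x⁆∣≤suc∣p∣ Last Fin.zero ⟩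
    suc ∣ Last ∣                 ≡⟨ cong suc ∣Last∣ ⟩
    suc k                        ∎

  minDegree : IsMinDegree (H (suc m) k) (suc k)
  minDegree = suc-k≤degU , suc-k≤degV ,
              inj₁ (Fin.zero , ≤-antisym degU-zero≤suc-k (suc-k≤degU Fin.zero))

H-forcingNumber≡minDegree∸1 : (n k : ℕ) → k ≤ n ∸ 1 → 1 ≤ n →
                              Σ ℕ (λ d → IsMinDegree (H n k) d × IsForcingNumber (H n k) (d ∸ 1))
H-forcingNumber≡minDegree∸1 zero    _ _   ()
H-forcingNumber≡minDegree∸1 (suc m) k k≤m _ =
  suc k , minDegree , (identityMatching k , Last , last-forces-identity k , ∣Last∣) ,
  λ M S forcing → s≤s⁻¹ (minDegree≤suc∣forcingSet∣ {M = M} minDegree forcing)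
  where open Tightness m k k≤m

theorem2p6 : ((n : ℕ) (G : BipGraph n) → HasPerfectMatching G →
    (d k : ℕ) → IsMinDegree G d → IsForcingNumber G k → d ∸ 1 ≤ k)
    × ((n k : ℕ) → k ≤ n ∸ 1 → 1 ≤ n →
    Σ ℕ (λ d → IsMinDegree (H n k) d × IsForcingNumber (H n k) (d ∸ 1)))
theorem2p6 = minDegree∸1≤forcingNumber , H-forcingNumber≡minDegree∸1
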